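{- Let $\mathcal{C}$ be a covering system whose moduli have least common multiple $L$, and let $q$ be a prime with $q^\alpha \,\|\, L$ for a positive integer $\alpha$. Let $p$ be a prime with $p \nmid L$ and $p < q$. Then there exists a covering system $\mathcal{C}_1$ whose moduli have least common multiple $L_1 = L p^\alpha / q^\alpha$. Moreover, if $\mathcal{C}$ is a distinct covering then so is $\mathcal{C}_1$, and if $n_1$ is the least modulus of $\mathcal{C}$, then the least modulus of $\mathcal{C}_1$ is at least $\min(n_1, p)$.
   Context: A covering system (covering) is a finite set of congruences $\{x \equiv r_i \pmod{n_i}\}$ with positive integer moduli such that every integer satisfies at least one of them. A covering is distinct if its moduli are pairwise distinct and greater than $1$. $q^\alpha \,\|\, L$ means $q^\alpha \mid L$ and $q^{\alpha+1}\nmid L$. -}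

module Defs where

open import Data.Nat as ℕ using (ℕ; _≤_; _<_)
open import Data.Nat.LCM using (lcm)
open import Data.Nat.Divisibility using (_∣_)
open import Relation.Nullary using (¬_)
open import Data.Integer as ℤ using (ℤ; +_; _-_)
open import Data.Integer.Divisibility as ℤD using ()
open import Data.Product using (_×_; _,_; proj₁; Σ; ∃)
open import Data.List using (List; map; foldr)
open import Data.List.Membership.Propositional using (_∈_)
open import Data.List.Relation.Unary.Any using (Any)
open import Data.List.Relation.Unary.All using (All)
open import Data.List.Relation.Unary.Unique.Propositional using (Unique)

Congruence : Set
Congruence = ℕ × ℤ

modulus : Congruence → ℕ
modulus = proj₁

Satisfies : ℤ → Congruence → Set
Satisfies x (n , r) = (+ n) ℤD.∣ (x - r)

System : Set
System = List Congruence

moduli : System → List ℕ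
moduli C = map modulus C

IsCovering : System → Set
IsCovering C = All (λ n → 1 ≤ n) (moduli C) × (∀ (x : ℤ) → Any (Satisfies x) C)

IsDistinctCovering : System → Set
IsDistinctCovering C = IsCovering C × Unique (moduli C) × All (λ n → 1 < n) (moduli C)

lcmModuli : System → ℕ
lcmModuli C = foldr lcm 1 (moduli C)

IsLeastModulus : System → ℕ → Set
IsLeastModulus C m = m ∈ moduli C × All (λ k → m ≤ k) (moduli C)

ExactPowerDivides : ℕ → ℕ → ℕ → Set
ExactPowerDivides q α L = (q ℕ.^ α) ∣ L × ¬ ((q ℕ.^ ℕ.suc α) ∣ L)

module Submission where

-- Write  L = M · q^α  with  q ∤ M.  Every modulus n ∣ L splits as  n = μ · q^β  with
-- β ≤ α and μ ∣ M; the system C₁ replaces it by  n' = μ · p^β.  Then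
-- lcm C₁ = M · p^α,  n' is n itself or a multiple of p (so n' ≥ min(n, p)), and
-- n ↦ n' is injective on such moduli because p ∤ μ, which keeps moduli distinct.
-- Covering rests on a digit transfer: writing z < p^α in base p and reading the
-- digits in base q gives D(z) < q^α, whose lowest β digits, reduced mod p and read
-- in base p, recover  z mod p^β.  Given x, the CRT point  y ≡ D(x mod p^α) (mod q^α),
-- y ≡ x (mod M)  lies in a class  r mod n  of C, and x then lies in the class of C₁
-- that is r mod μ and, mod p^β, the digit transfer of  r mod q^β.

open import Defs
open import Data.Nat as ℕ
  using (ℕ; zero; suc; _+_; _*_; _∸_; _^_; _≤_; _<_; _⊓_; pred; NonZero; z≤n; s≤s)
open import Data.Nat.Properties
open import Data.Nat.DivMod using (_/_; _%_; m%n<n; m≡m%n+[m/n]*n; m∣n⇒o%n%m≡o%m;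
  m%[n*o]/o≡m/o%n; m%n%n≡m%n; [m+kn]%n≡m%n; m<n⇒m%n≡m; +-distrib-/-∣ʳ; m<n⇒m/n≡0;
  m*n/n≡m; n%1≡0)
open import Data.Nat.Divisibility
open import Data.Nat.Coprimality as Coprime using (Coprime; coprime-divisor; coprime⇒gcd≡1)
open import Data.Nat.GCD using (gcd-GCD; module Bézout)
open import Data.Nat.LCM using (lcm; m∣lcm[m,n]; n∣lcm[m,n]; lcm-least; gcd*lcm)
open import Data.Nat.Primality using (Prime; prime⇒irreducible; prime⇒nonZero; prime⇒nonTrivial)
open import Data.Integer as ℤ using (ℤ; +_; _⊖_; _%ℕ_; _/ℕ_)
  renaming (_+_ to _+ᶻ_; _-_ to _-ᶻ_; _*_ to _*ᶻ_; -_ to -ᶻ_)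
import Data.Integer.Properties as ℤ
import Data.Integer.DivMod as ℤ
open import Data.Integer.Divisibility.Signed as Signed using (∣⇒∣ᵤ; ∣ᵤ⇒∣)
  renaming (_∣_ to _∣ᶻ_)
open import Data.Integer.Tactic.RingSolver using (solve-∀)
open import Data.List using (List; []; _∷_; map; foldr)
open import Data.List.Properties using (map-∘)
open import Data.List.Relation.Unary.All as All using (All; []; _∷_)
import Data.List.Relation.Unary.All.Properties as All
open import Data.List.Relation.Unary.Any as Any using (Any; here; there)
open import Data.List.Relation.Unary.AllPairs using (AllPairs; []; _∷_)
open import Data.List.Relation.Unary.Unique.Propositional using (Unique)
open import Data.List.Membership.Propositional using (_∈_; find)
open import Data.List.Membership.Propositional.Properties using (∈-map⁺; ∈-map⁻)
open import Data.Product using (_×_; _,_; proj₁; proj₂; Σ)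
open import Data.Sum using (_⊎_; inj₁; inj₂; [_,_]′)
open import Function using (_∘_)
open import Relation.Nullary using (¬_; yes; no; contradiction)
open import Relation.Binary.PropositionalEquality hiding ([_])

^-monoʳ-∣ : ∀ m {i j} → i ≤ j → m ^ i ∣ m ^ j
^-monoʳ-∣ m {i} {j} i≤j = divides (m ^ (j ∸ i)) (begin
  m ^ j                 ≡⟨ cong (m ^_) (m+[n∸m]≡n i≤j) ⟨
  m ^ (i + (j ∸ i))     ≡⟨ ^-distribˡ-+-* m i (j ∸ i) ⟩
  m ^ i * m ^ (j ∸ i)   ≡⟨ *-comm (m ^ i) _ ⟩
  m ^ (j ∸ i) * m ^ i   ∎)
  where open ≡-Reasoning

prime∤⇒coprime : ∀ {p m} → Prime p → ¬ p ∣ m → Coprime p m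
prime∤⇒coprime p-prime p∤m (d∣p , d∣m) with prime⇒irreducible p-prime d∣p
... | inj₁ d≡1  = d≡1
... | inj₂ refl = contradiction d∣m p∤m

coprime-*ʳ : ∀ {a b c} → Coprime a b → Coprime a c → Coprime a (b * c)
coprime-*ʳ {b = b} a⊥b a⊥c (d∣a , d∣bc) = a⊥c (d∣a , coprime-divisor d⊥b d∣bc)
  where
  d⊥b : Coprime _ b
  d⊥b (e∣d , e∣b) = a⊥b (∣-trans e∣d d∣a , e∣b)

coprime-^ʳ : ∀ {a b} k → Coprime a b → Coprime a (b ^ k)
coprime-^ʳ zero    _   (_ , d∣1) = ∣1⇒≡1 d∣1
coprime-^ʳ (suc k) a⊥b = coprime-*ʳ a⊥b (coprime-^ʳ k a⊥b)

prime^-coprime : ∀ {p m} k → Prime p → ¬ p ∣ m → Coprime (p ^ k) m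
prime^-coprime k p-prime p∤m = Coprime.sym (coprime-^ʳ k (Coprime.sym (prime∤⇒coprime p-prime p∤m)))

coprime⇒*∣ : ∀ {a b c} → Coprime a b → a ∣ c → b ∣ c → a * b ∣ c
coprime⇒*∣ {a} {b} a⊥b a∣c b∣c = subst (_∣ _) lcm≡* (lcm-least a∣c b∣c)
  where
  lcm≡* : lcm a b ≡ a * b
  lcm≡* = trans (sym (*-identityˡ (lcm a b)))
                (trans (cong (_* lcm a b) (sym (coprime⇒gcd≡1 a⊥b))) (gcd*lcm a b))

^*-cancel : ∀ {p} .{{_ : NonZero p}} b c {m m'} → ¬ p ∣ m → ¬ p ∣ m' →
            p ^ b * m ≡ p ^ c * m' → b ≡ c × m ≡ m'
^*-cancel zero    zero    {m} {m'} _ _ eq = refl , trans (sym (*-identityˡ m)) (trans eq (*-identityˡ m'))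
^*-cancel {p} zero (suc c) {m} {m'} p∤m _ eq =
  contradiction (divides (p ^ c * m') (trans (sym (*-identityˡ m))
    (trans eq (trans (*-assoc p (p ^ c) m') (*-comm p _))))) p∤m
^*-cancel {p} (suc b) zero {m} {m'} _ p∤m' eq =
  contradiction (divides (p ^ b * m) (trans (sym (*-identityˡ m'))
    (trans (sym eq) (trans (*-assoc p (p ^ b) m) (*-comm p _))))) p∤m'
^*-cancel {p} (suc b) (suc c) {m} {m'} p∤m p∤m' eq
  with ^*-cancel b c p∤m p∤m'
         (*-cancelˡ-≡ _ _ p (trans (sym (*-assoc p (p ^ b) m)) (trans eq (*-assoc p (p ^ c) m'))))
... | refl , refl = refl , refl

-- Congruence of integers.  Its field is literally  Satisfies x (n , y);  the record
-- wrapper keeps x, y and n inferable.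
infix 4 _≡_mod_
record _≡_mod_ (x y : ℤ) (n : ℕ) : Set where
  constructor congruent
  field
    divides-difference : n ∣ ℤ.∣ x -ᶻ y ∣
open _≡_mod_ public

≡mod-sym : ∀ {x y n} → x ≡ y mod n → y ≡ x mod n
≡mod-sym {x} {y} {n} (congruent n∣x-y) = congruent (subst (n ∣_) (ℤ.∣i-j∣≡∣j-i∣ x y) n∣x-y)

≡mod-trans : ∀ {x y z n} → x ≡ y mod n → y ≡ z mod n → x ≡ z mod n
≡mod-trans {x} {y} {z} {n} (congruent n∣x-y) (congruent n∣y-z) = congruent (∣⇒∣ᵤ
  (subst (+ n ∣ᶻ_) (telescope x y z) (Signed.∣m∣n⇒∣m+n (∣ᵤ⇒∣ {i = x -ᶻ y} n∣x-y) (∣ᵤ⇒∣ {i = y -ᶻ z} n∣y-z))))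
  where
  telescope : ∀ (x y z : ℤ) → (x -ᶻ y) +ᶻ (y -ᶻ z) ≡ x -ᶻ z
  telescope = solve-∀

≡mod-∣ : ∀ {x y d n} → d ∣ n → x ≡ y mod n → x ≡ y mod d
≡mod-∣ d∣n (congruent n∣x-y) = congruent (∣-trans d∣n n∣x-y)

≡mod-coprime : ∀ {x y a b} → Coprime a b → x ≡ y mod a → x ≡ y mod b → x ≡ y mod a * b
≡mod-coprime a⊥b (congruent a∣x-y) (congruent b∣x-y) = congruent (coprime⇒*∣ a⊥b a∣x-y b∣x-y)

≡mod-residue : ∀ n .{{_ : NonZero n}} x → x ≡ + (x %ℕ n) mod n
≡mod-residue n x = congruent (∣⇒∣ᵤ (Signed.divides (x /ℕ n) (begin
  x -ᶻ + (x %ℕ n)                            ≡⟨ cong (_-ᶻ + (x %ℕ n)) (ℤ.a≡a%ℕn+[a/ℕn]*n x n) ⟩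
  (+ (x %ℕ n) +ᶻ (x /ℕ n) *ᶻ + n) -ᶻ + (x %ℕ n) ≡⟨ cancel (+ (x %ℕ n)) ((x /ℕ n) *ᶻ + n) ⟩
  (x /ℕ n) *ᶻ + n                             ∎)))
  where
  open ≡-Reasoning
  cancel : ∀ (s t : ℤ) → (s +ᶻ t) -ᶻ s ≡ t
  cancel = solve-∀

<∧∣⇒≡0 : ∀ {m n} → m < n → n ∣ m → m ≡ 0
<∧∣⇒≡0 {zero}  _   _   = refl
<∧∣⇒≡0 {suc m} m<n n∣m = contradiction n∣m (>⇒∤ {suc m} m<n)

ordered-residues-≡ : ∀ {s t n} → t ≤ s → s < n → n ∣ ℤ.∣ s ⊖ t ∣ → s ≡ t
ordered-residues-≡ {s} {t} t≤s s<n n∣s⊖t rewrite ℤ.⊖-≥ t≤s =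
  ≤-antisym (m∸n≡0⇒m≤n (<∧∣⇒≡0 (≤-<-trans (m∸n≤m s t) s<n) n∣s⊖t)) t≤s

residues-≡ : ∀ {s t n} → s < n → t < n → + s ≡ + t mod n → s ≡ t
residues-≡ {s} {t} {n} s<n t<n (congruent n∣s-t) =
  [ (λ t≤s → ordered-residues-≡ t≤s s<n n∣s⊖t)
  , (λ s≤t → sym (ordered-residues-≡ s≤t t<n (subst (n ∣_) (ℤ.∣m⊖n∣≡∣n⊖m∣ s t) n∣s⊖t)))
  ]′ (≤-total t s)
  where
  n∣s⊖t : n ∣ ℤ.∣ s ⊖ t ∣
  n∣s⊖t = subst (n ∣_) (cong ℤ.∣_∣ (ℤ.[+m]-[+n]≡m⊖n s t)) n∣s-t

≡mod⇒%ℕ≡ : ∀ n .{{_ : NonZero n}} {x y} → x ≡ y mod n → x %ℕ n ≡ y %ℕ n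
≡mod⇒%ℕ≡ n {x} {y} x≡y = residues-≡ (ℤ.n%ℕd<d x n) (ℤ.n%ℕd<d y n)
  (≡mod-trans (≡mod-sym (≡mod-residue n x)) (≡mod-trans x≡y (≡mod-residue n y)))

-- From a Bézout identity for A and B we read off an
-- integer e with  e ≡ 0 mod A  and  e ≡ 1 mod B  (when gcd A B = 1); then
-- a + (b - a)·e  solves both congruences.  The solution is defined for all A, B so
-- that it can be used inside a plain function on congruences.
bézoutIdempotent : ∀ {d A B} → Bézout.Identity d A B → ℤ
bézoutIdempotent {A = A} (Bézout.+- x _ _) = + (x * A)
bézoutIdempotent {A = A} (Bézout.-+ x _ _) = -ᶻ (+ (x * A))

bézoutIdempotent-spec : ∀ {d A B} (i : Bézout.Identity d A B) → d ≡ 1 →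
  (+ A ∣ᶻ bézoutIdempotent i) × (+ B ∣ᶻ (+ 1 -ᶻ bézoutIdempotent i))
bézoutIdempotent-spec {A = A} {B} (Bézout.+- x y 1+yB≡xA) refl =
  Signed.divides (+ x) (ℤ.pos-* x A) ,
  Signed.divides (-ᶻ + y) (begin
    + 1 -ᶻ + (x * A)              ≡⟨ cong (λ t → + 1 -ᶻ + t) 1+yB≡xA ⟨
    + 1 -ᶻ + (1 + y * B)          ≡⟨ cong (λ t → + 1 -ᶻ (+ 1 +ᶻ t)) (ℤ.pos-* y B) ⟩
    + 1 -ᶻ (+ 1 +ᶻ + y *ᶻ + B)    ≡⟨ rearrange (+ y) (+ B) ⟩
    -ᶻ + y *ᶻ + B                 ∎)
  where
  open ≡-Reasoning
  rearrange : ∀ (u v : ℤ) → + 1 -ᶻ (+ 1 +ᶻ u *ᶻ v) ≡ -ᶻ u *ᶻ v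
  rearrange = solve-∀
bézoutIdempotent-spec {A = A} {B} (Bézout.-+ x y 1+xA≡yB) refl =
  Signed.∣m⇒∣-m (Signed.divides (+ x) (ℤ.pos-* x A)) ,
  Signed.divides (+ y) (begin
    + 1 -ᶻ -ᶻ + (x * A)    ≡⟨ rearrange (+ (x * A)) ⟩
    + (1 + x * A)          ≡⟨ cong +_ 1+xA≡yB ⟩
    + (y * B)              ≡⟨ ℤ.pos-* y B ⟩
    + y *ᶻ + B             ∎)
  where
  open ≡-Reasoning
  rearrange : ∀ (u : ℤ) → + 1 -ᶻ -ᶻ u ≡ + 1 +ᶻ u
  rearrange = solve-∀

crt : ℕ → ℕ → ℤ → ℤ → ℤ
crt A B a b = a +ᶻ (b -ᶻ a) *ᶻ bézoutIdempotent (Bézout.identity (gcd-GCD A B))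

crt-spec : ∀ {A B} → Coprime A B → ∀ a b → crt A B a b ≡ a mod A × crt A B a b ≡ b mod B
crt-spec {A} {B} A⊥B a b = congruent (∣⇒∣ᵤ (subst (+ A ∣ᶻ_) (sym (shiftA a b e)) (Signed.∣n⇒∣m*n (b -ᶻ a) A∣e)))
                          , congruent (∣⇒∣ᵤ (subst (+ B ∣ᶻ_) (sym (shiftB a b e)) (Signed.∣n⇒∣m*n (a -ᶻ b) B∣1-e)))
  where
  identity = Bézout.identity (gcd-GCD A B)
  e = bézoutIdempotent identity
  spec = bézoutIdempotent-spec identity (coprime⇒gcd≡1 A⊥B)
  A∣e = proj₁ spec
  B∣1-e = proj₂ spec
  shiftA : ∀ (a b e : ℤ) → (a +ᶻ (b -ᶻ a) *ᶻ e) -ᶻ a ≡ (b -ᶻ a) *ᶻ e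
  shiftA = solve-∀
  shiftB : ∀ (a b e : ℤ) → (a +ᶻ (b -ᶻ a) *ᶻ e) -ᶻ b ≡ (a -ᶻ b) *ᶻ (+ 1 -ᶻ e)
  shiftB = solve-∀

lcmList : List ℕ → ℕ
lcmList = foldr lcm 1

∈⇒∣lcmList : ∀ {x xs} → x ∈ xs → x ∣ lcmList xs
∈⇒∣lcmList {xs = y ∷ ys} (here refl) = m∣lcm[m,n] y (lcmList ys)
∈⇒∣lcmList {xs = y ∷ ys} (there x∈ys) = ∣-trans (∈⇒∣lcmList x∈ys) (n∣lcm[m,n] y (lcmList ys))

lcmList-least : ∀ {c xs} → All (_∣ c) xs → lcmList xs ∣ c
lcmList-least []           = 1∣ _
lcmList-least (x∣c ∷ xs∣c) = lcm-least x∣c (lcmList-least xs∣c)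

Any-map-guarded : ∀ {A B : Set} {P Q : A → Set} {R : B → Set} (g : A → B) →
                  (∀ {a} → P a → Q a → R (g a)) →
                  ∀ {xs} → All P xs → Any Q xs → Any R (map g xs)
Any-map-guarded g h (pa ∷ _)  (here qa)  = here (h pa qa)
Any-map-guarded g h (_ ∷ pas) (there qs) = there (Any-map-guarded g h pas qs)

AllPairs-map-guarded : ∀ {A B : Set} {P : A → Set} {R : A → A → Set} {S : B → B → Set} (f : A → B) →
                       (∀ {x y} → P x → P y → R x y → S (f x) (f y)) →
                       ∀ {xs} → All P xs → AllPairs R xs → AllPairs S (map f xs)
AllPairs-map-guarded f h []        []          = []
AllPairs-map-guarded f h (px ∷ ps) (rx ∷ rxs) =
  All.map⁺ (All.zipWith (λ (py , rxy) → h px py rxy) (ps , rx)) ∷ AllPairs-map-guarded f h ps rxs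

%[o*n]/o≡/o%n : ∀ m n o .{{_ : NonZero n}} .{{_ : NonZero o}} .{{_ : NonZero (o * n)}} →
                m % (o * n) / o ≡ m / o % n
%[o*n]/o≡/o%n m n o rewrite *-comm o n = m%[n*o]/o≡m/o%n m n o {{_}} {{_}} {{m*n≢0 n o}}

%-split : ∀ m n o .{{_ : NonZero n}} .{{_ : NonZero o}} .{{_ : NonZero (o * n)}} →
          m % (o * n) ≡ m % o + (m / o % n) * o
%-split m n o = begin
  m % (o * n)                              ≡⟨ m≡m%n+[m/n]*n (m % (o * n)) o ⟩
  m % (o * n) % o + (m % (o * n) / o) * o  ≡⟨ cong₂ (λ u v → u + v * o)
                                                  (m∣n⇒o%n%m≡o%m o (o * n) m (m∣m*n n)) (%[o*n]/o≡/o%n m n o) ⟩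
  m % o + (m / o % n) * o                  ∎
  where open ≡-Reasoning

-- Digit transfer between bases b < a.  embed K z reads the K lowest base-b digits
-- of z in base a; retract k w reduces the k lowest base-a digits of w modulo b and
-- reads them in base b.  retract only sees w mod a^k, and it undoes embed modulo b^k.
module DigitTransfer (a b : ℕ) .{{_ : NonZero a}} .{{_ : NonZero b}} (b<a : b < a) where

  embed : ℕ → ℕ → ℕ
  embed zero    z = 0
  embed (suc K) z = z % b + a * embed K (z / b)

  retract : ℕ → ℕ → ℕ
  retract zero    w = 0
  retract (suc k) w = w % a % b + b * retract k (w / a)

  retract-mod : ∀ k w .{{_ : NonZero (a ^ k)}} → retract k (w % a ^ k) ≡ retract k w
  retract-mod zero    w = refl
  retract-mod (suc k) w =
    cong₂ (λ u v → u % b + b * v) lowest-digit (trans (cong (retract k) higher-digits) (retract-mod k (w / a)))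
    where
    instance
      a^k≢0 : NonZero (a ^ k)
      a^k≢0 = m^n≢0 a k
    lowest-digit : w % (a * a ^ k) % a ≡ w % a
    lowest-digit = m∣n⇒o%n%m≡o%m a (a * a ^ k) w {{_}} {{m*n≢0 a (a ^ k)}} (m∣m*n (a ^ k))
    higher-digits : w % (a * a ^ k) / a ≡ w / a % a ^ k
    higher-digits = %[o*n]/o≡/o%n w (a ^ k) a {{_}} {{_}} {{m*n≢0 a (a ^ k)}}

  digit-% : ∀ z X → (z % b + a * X) % a ≡ z % b
  digit-% z X = trans (cong (λ t → (z % b + t) % a) (*-comm a X))
                      (trans ([m+kn]%n≡m%n (z % b) X a) (m<n⇒m%n≡m (<-trans (m%n<n z b) b<a)))

  digit-/ : ∀ z X → (z % b + a * X) / a ≡ X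
  digit-/ z X = begin
    (z % b + a * X) / a      ≡⟨ +-distrib-/-∣ʳ (z % b) (m∣m*n X) ⟩
    z % b / a + a * X / a    ≡⟨ cong₂ _+_ (m<n⇒m/n≡0 (<-trans (m%n<n z b) b<a))
                                          (trans (cong (_/ a) (*-comm a X)) (m*n/n≡m X a)) ⟩
    X                        ∎
    where open ≡-Reasoning

  retract-embed : ∀ k K → k ≤ K → ∀ z .{{_ : NonZero (b ^ k)}} → retract k (embed K z) ≡ z % b ^ k
  retract-embed zero    K       _         z = sym (n%1≡0 z)
  retract-embed (suc k) (suc K) (s≤s k≤K) z = begin
    retract (suc k) (z % b + a * X)
      ≡⟨ cong₂ (λ u v → u % b + b * retract k v) (digit-% z X) (digit-/ z X) ⟩
    z % b % b + b * retract k X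
      ≡⟨ cong₂ (λ u v → u + b * v) (m%n%n≡m%n z b) (retract-embed k K k≤K (z / b)) ⟩
    z % b + b * (z / b % b ^ k)
      ≡⟨ cong (_+_ (z % b)) (*-comm b _) ⟩
    z % b + (z / b % b ^ k) * b
      ≡⟨ %-split z (b ^ k) b {{_}} {{_}} {{m*n≢0 b (b ^ k)}} ⟨
    z % (b * b ^ k)
      ∎
    where
    open ≡-Reasoning
    X = embed K (z / b)
    instance
      b^k≢0 : NonZero (b ^ k)
      b^k≢0 = m^n≢0 b k

module TruncatedValuation (q n : ℕ) where

  val : ℕ → ℕ
  val zero = 0
  val (suc k) with q ^ suc k ∣? n
  ... | yes _ = suc k
  ... | no  _ = val k

  val-∣ : ∀ k → q ^ val k ∣ n
  val-∣ zero = 1∣ n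
  val-∣ (suc k) with q ^ suc k ∣? n
  ... | yes q^k+1∣n = q^k+1∣n
  ... | no  _       = val-∣ k

  val-≤ : ∀ k → val k ≤ k
  val-≤ zero = z≤n
  val-≤ (suc k) with q ^ suc k ∣? n
  ... | yes _ = ≤-refl
  ... | no  _ = m≤n⇒m≤1+n (val-≤ k)

  val-maximal : ∀ k {j} → val k < j → j ≤ k → ¬ q ^ j ∣ n
  val-maximal zero    v<j j≤0 = contradiction j≤0 (<⇒≱ v<j)
  val-maximal (suc k) {j} v<j j≤k+1 with q ^ suc k ∣? n
  ... | yes _       = contradiction j≤k+1 (<⇒≱ v<j)
  ... | no  q^k+1∤n with m≤n⇒m<n∨m≡n j≤k+1
  ...   | inj₁ j<k+1 = val-maximal k v<j (ℕ.s≤s⁻¹ j<k+1)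
  ...   | inj₂ refl  = q^k+1∤n

^*-shape : ∀ p {q} b m .{{_ : NonZero p}} → 1 ≤ m → p ^ b * m ≡ m * q ^ b ⊎ p ≤ p ^ b * m
^*-shape p zero    m _   = inj₁ (trans (*-identityˡ m) (sym (*-identityʳ m)))
^*-shape p (suc b) m m≥1 = inj₂ (subst (p ≤_) (sym (*-assoc p (p ^ b) m))
                                  (m≤m*n p (p ^ b * m) {{m*n≢0 (p ^ b) m {{m^n≢0 p b}} {{ℕ.>-nonZero m≥1}}}}))

module Transformation (q p α M : ℕ) (q-prime : Prime q) (p-prime : Prime p) (p<q : p < q)
                      (q∤M : ¬ q ∣ M) (p∤M : ¬ p ∣ M) where

  instance
    q≢0 : NonZero q
    q≢0 = prime⇒nonZero q-prime
    p≢0 : NonZero p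
    p≢0 = prime⇒nonZero p-prime

  q^≢0 : ∀ k → NonZero (q ^ k)
  q^≢0 k = m^n≢0 q k
  p^≢0 : ∀ k → NonZero (p ^ k)
  p^≢0 k = m^n≢0 p k

  open DigitTransfer q p p<q

  L : ℕ
  L = M * q ^ α

  β : ℕ → ℕ
  β n = TruncatedValuation.val q n α

  q^β∣ : ∀ n → q ^ β n ∣ n
  q^β∣ n = TruncatedValuation.val-∣ q n α

  μ : ℕ → ℕ
  μ n = quotient (q^β∣ n)

  n≡μ*q^β : ∀ n → n ≡ μ n * q ^ β n
  n≡μ*q^β n = m∣n⇒n≡quotient*m (q^β∣ n)

  newModulus : ℕ → ℕ
  newModulus n = p ^ β n * μ n

  newResidue : ℕ → ℤ → ℕ
  newResidue n r = retract (β n) (_%ℕ_ r (q ^ β n) {{q^≢0 (β n)}})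

  transform : Congruence → Congruence
  transform (n , r) = newModulus n , crt (μ n) (p ^ β n) r (+ newResidue n r)

  record Admissible (n : ℕ) : Set where
    field
      β≤α : β n ≤ α
      μ∣M : μ n ∣ M
      μ≥1 : 1 ≤ μ n

  q∣μ⇒q^β+1∣ : ∀ {n} → q ∣ μ n → q ^ suc (β n) ∣ n
  q∣μ⇒q^β+1∣ {n} q∣μ = subst (q * q ^ β n ∣_) (sym (n≡μ*q^β n)) (*-monoˡ-∣ (q ^ β n) q∣μ)

  -- μ n carries no factor q: otherwise q^(β n + 1) would divide n, against the
  -- maximality of β n when β n < α, and against  q^(α+1) ∤ L  when β n = α.
  q∤μ : ∀ {n} → n ∣ L → ¬ q ∣ μ n
  q∤μ {n} n∣L q∣μ with m≤n⇒m<n∨m≡n (TruncatedValuation.val-≤ q n α)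
  ... | inj₁ β<α = TruncatedValuation.val-maximal q n α ≤-refl β<α (q∣μ⇒q^β+1∣ q∣μ)
  ... | inj₂ β≡α = q∤M (*-cancelʳ-∣ (q ^ α) {{q^≢0 α}} (∣-trans q^α+1∣n n∣L))
    where
    q^α+1∣n : q * q ^ α ∣ n
    q^α+1∣n = subst (λ k → q ^ suc k ∣ n) β≡α (q∣μ⇒q^β+1∣ q∣μ)

  admissible : ∀ {n} → n ∣ L → 1 ≤ n → Admissible n
  admissible {n} n∣L n≥1 = record
    { β≤α = TruncatedValuation.val-≤ q n α
    ; μ∣M = μ∣M
    ; μ≥1 = μ≥1
    }
    where
    μ∣M : μ n ∣ M
    μ∣M = coprime-divisor (Coprime.sym (prime^-coprime α q-prime (q∤μ n∣L)))
            (subst (μ n ∣_) (*-comm M (q ^ α)) (∣-trans (quotient-∣ (q^β∣ n)) n∣L))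
    μ≥1 : 1 ≤ μ n
    μ≥1 = ℕ.>-nonZero⁻¹ (μ n) {{m*n≢0⇒m≢0 (μ n) {{subst NonZero (n≡μ*q^β n) (ℕ.>-nonZero n≥1)}}}}

  p∤μ : ∀ {n} → Admissible n → ¬ p ∣ μ n
  p∤μ adm p∣μ = p∤M (∣-trans p∣μ (Admissible.μ∣M adm))

  newModulus-shape : ∀ {n} → Admissible n → newModulus n ≡ n ⊎ p ≤ newModulus n
  newModulus-shape {n} adm with ^*-shape p {q} (β n) (μ n) (Admissible.μ≥1 adm)
  ... | inj₁ kept = inj₁ (trans kept (sym (n≡μ*q^β n)))
  ... | inj₂ p≤   = inj₂ p≤

  1<p : 1 < p
  1<p = ℕ.nonTrivial⇒n>1 p {{prime⇒nonTrivial p-prime}}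

  newModulus-≥ : ∀ {n k} → Admissible n → k ≤ n → k ⊓ p ≤ newModulus n
  newModulus-≥ {n} {k} adm k≤n with newModulus-shape adm
  ... | inj₁ kept = subst (k ⊓ p ≤_) (sym kept) (≤-trans (m⊓n≤m k p) k≤n)
  ... | inj₂ p≤   = ≤-trans (m⊓n≤n k p) p≤

  newModulus-> : ∀ {n k} → Admissible n → k < p → k < n → k < newModulus n
  newModulus-> {n} {k} adm k<p k<n with newModulus-shape adm
  ... | inj₁ kept = subst (k <_) (sym kept) k<n
  ... | inj₂ p≤   = <-≤-trans k<p p≤

  newModulus-injective : ∀ {n n'} → Admissible n → Admissible n' → newModulus n ≡ newModulus n' → n ≡ n'
  newModulus-injective {n} {n'} adm adm' eq with ^*-cancel (β n) (β n') (p∤μ adm) (p∤μ adm') eq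
  ... | β≡ , μ≡ = trans (n≡μ*q^β n) (trans (cong₂ (λ m b → m * q ^ b) μ≡ β≡) (sym (n≡μ*q^β n')))

  pull : ℤ → ℤ
  pull x = crt (q ^ α) M (+ embed α (_%ℕ_ x (p ^ α) {{p^≢0 α}})) x

  pull-spec : ∀ x → pull x ≡ + embed α (_%ℕ_ x (p ^ α) {{p^≢0 α}}) mod q ^ α × pull x ≡ x mod M
  pull-spec x = crt-spec (prime^-coprime α q-prime q∤M) _ x

  newResidue-pull : ∀ {n r} x → Admissible n → pull x ≡ r mod n →
                    newResidue n r ≡ _%_ (_%ℕ_ x (p ^ α) {{p^≢0 α}}) (p ^ β n) {{p^≢0 (β n)}}
  newResidue-pull {n} {r} x adm pull≡r = begin
    retract b (_%ℕ_ r (q ^ b) {{q^≢0 b}})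
      ≡⟨ cong (retract b) (≡mod⇒%ℕ≡ (q ^ b) {{q^≢0 b}} (≡mod-∣ (q^β∣ n) (≡mod-sym pull≡r))) ⟩
    retract b (_%ℕ_ (pull x) (q ^ b) {{q^≢0 b}})
      ≡⟨ cong (retract b) (≡mod⇒%ℕ≡ (q ^ b) {{q^≢0 b}}
                            (≡mod-∣ (^-monoʳ-∣ q β≤α) (proj₁ (pull-spec x)))) ⟩
    retract b (_%_ (embed α z) (q ^ b) {{q^≢0 b}})
      ≡⟨ retract-mod b (embed α z) {{q^≢0 b}} ⟩
    retract b (embed α z)
      ≡⟨ retract-embed b α β≤α z {{p^≢0 b}} ⟩
    _%_ z (p ^ b) {{p^≢0 b}}
      ∎
    where
    open ≡-Reasoning
    open Admissible adm
    b = β n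
    z = _%ℕ_ x (p ^ α) {{p^≢0 α}}

  transform-pulls-back : ∀ {n r} x → Admissible n → pull x ≡ r mod n →
                         x ≡ proj₂ (transform (n , r)) mod newModulus n
  transform-pulls-back {n} {r} x adm pull≡r = ≡mod-coprime p^β⊥μ x≡r′-mod-p^β x≡r′-mod-μ
    where
    open Admissible adm
    b = β n
    z = _%ℕ_ x (p ^ α) {{p^≢0 α}}
    p^β⊥μ : Coprime (p ^ b) (μ n)
    p^β⊥μ = prime^-coprime b p-prime (p∤μ adm)
    r′ = crt (μ n) (p ^ b) r (+ newResidue n r)
    r′-spec = crt-spec (Coprime.sym p^β⊥μ) r (+ newResidue n r)

    x≡r′-mod-μ : x ≡ r′ mod μ n
    x≡r′-mod-μ = ≡mod-trans (≡mod-∣ μ∣M (≡mod-sym (proj₂ (pull-spec x))))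
                   (≡mod-trans (≡mod-∣ (quotient-∣ (q^β∣ n)) pull≡r) (≡mod-sym (proj₁ r′-spec)))

    x≡r′-mod-p^β : x ≡ r′ mod p ^ b
    x≡r′-mod-p^β = ≡mod-trans (≡mod-∣ (^-monoʳ-∣ p β≤α) (≡mod-residue (p ^ α) {{p^≢0 α}} x))
                     (≡mod-trans (subst (λ t → + z ≡ + t mod p ^ b) (sym (newResidue-pull x adm pull≡r))
                                        (≡mod-residue (p ^ b) {{p^≢0 b}} (+ z)))
                                 (≡mod-sym (proj₂ r′-spec)))

  module TransformedLcm {ms : List ℕ} (adm : All Admissible ms) (lcm≡L : lcmList ms ≡ L) where

    L₁ : ℕ
    L₁ = lcmList (map newModulus ms)

    newModulus∣L₁ : ∀ {n} → n ∈ ms → newModulus n ∣ L₁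
    newModulus∣L₁ n∈ms = ∈⇒∣lcmList (∈-map⁺ newModulus n∈ms)

    L₁∣p^α*M : L₁ ∣ p ^ α * M
    L₁∣p^α*M = lcmList-least (All.map⁺ (All.map (λ a →
      *-pres-∣ (^-monoʳ-∣ p (Admissible.β≤α a)) (Admissible.μ∣M a)) adm))

    -- Each n = μ · q^β divides  L₁ · q^α,  hence so does L = M · q^α.
    M∣L₁ : M ∣ L₁
    M∣L₁ = *-cancelʳ-∣ (q ^ α) {{q^≢0 α}} (subst (_∣ L₁ * q ^ α) lcm≡L
      (lcmList-least (All.tabulate λ {n} n∈ms → subst (_∣ L₁ * q ^ α) (sym (n≡μ*q^β n))
        (*-pres-∣ (∣-trans (n∣m*n (p ^ β n)) (newModulus∣L₁ n∈ms))
                  (^-monoʳ-∣ q (Admissible.β≤α (All.lookup adm n∈ms)))))))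

    -- Some modulus has the full q-part q^α: otherwise all of them, and so L,
    -- would divide  M · q^(α-1),  forcing q ∣ M.
    full-q-part : 1 ≤ α → Any (λ n → β n ≡ α) ms
    full-q-part α≥1 with Any.any? (λ n → β n ≟ α) ms
    ... | yes some = some
    ... | no  none = contradiction (*-cancelʳ-∣ (q ^ α′) {{q^≢0 α′}} q^α∣M*q^α′) q∤M
      where
      α′ = pred α
      α≡ : suc α′ ≡ α
      α≡ = suc-pred α {{ℕ.>-nonZero α≥1}}
      ∣M*q^α′ : ∀ {n} → n ∈ ms → n ∣ M * q ^ α′
      ∣M*q^α′ {n} n∈ms = subst (_∣ M * q ^ α′) (sym (n≡μ*q^β n)) (*-pres-∣ μ∣M (^-monoʳ-∣ q β≤α′))
        where
        open Admissible (All.lookup adm n∈ms)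
        β≤α′ : β n ≤ α′
        β≤α′ = <⇒≤pred (≤∧≢⇒< β≤α (All.lookup (All.¬Any⇒All¬ ms none) n∈ms))
      q^α∣M*q^α′ : q * q ^ α′ ∣ M * q ^ α′
      q^α∣M*q^α′ = subst (λ k → q ^ k ∣ M * q ^ α′) (sym α≡)
        (∣-trans (n∣m*n M) (subst (_∣ M * q ^ α′) lcm≡L (lcmList-least (All.tabulate ∣M*q^α′))))

    p^α∣L₁ : 1 ≤ α → p ^ α ∣ L₁
    p^α∣L₁ α≥1 with find (full-q-part α≥1)
    ... | n , n∈ms , β≡α =
      ∣-trans (subst (λ k → p ^ k ∣ newModulus n) β≡α (m∣m*n (μ n))) (newModulus∣L₁ n∈ms)

    L₁≡p^α*M : 1 ≤ α → L₁ ≡ p ^ α * M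
    L₁≡p^α*M α≥1 = ∣-antisym L₁∣p^α*M (coprime⇒*∣ (prime^-coprime α p-prime p∤M) (p^α∣L₁ α≥1) M∣L₁)

  module TransformedSystem (C : System) (C-covers : IsCovering C) (lcm≡L : lcmModuli C ≡ L) where

    C₁ : System
    C₁ = map transform C

    moduli-C₁ : moduli C₁ ≡ map newModulus (moduli C)
    moduli-C₁ = trans (sym (map-∘ C)) (map-∘ C)

    adm : All Admissible (moduli C)
    adm = All.tabulate λ n∈C →
      admissible (subst (_ ∣_) lcm≡L (∈⇒∣lcmList n∈C)) (All.lookup (proj₁ C-covers) n∈C)

    -- C₁ covers x because C covers pull x.
    C₁-covers : IsCovering C₁
    C₁-covers =
      subst (All (1 ≤_)) (sym moduli-C₁)
        (All.map⁺ (All.zipWith (λ (a , n≥1) → newModulus-> a (ℕ.>-nonZero⁻¹ p) n≥1) (adm , proj₁ C-covers))) ,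
      λ x → Any-map-guarded transform
              (λ a sat → divides-difference (transform-pulls-back x a (congruent sat)))
              (All.map⁻ adm) (proj₂ C-covers (pull x))

    C₁-lcm : 1 ≤ α → lcmModuli C₁ * q ^ α ≡ lcmModuli C * p ^ α
    C₁-lcm α≥1 = begin
      lcmList (moduli C₁) * q ^ α  ≡⟨ cong (λ ms → lcmList ms * q ^ α) moduli-C₁ ⟩
      L₁ * q ^ α                   ≡⟨ cong (_* q ^ α) (L₁≡p^α*M α≥1) ⟩
      p ^ α * M * q ^ α            ≡⟨ trans (*-assoc (p ^ α) M (q ^ α)) (*-comm (p ^ α) (M * q ^ α)) ⟩
      M * q ^ α * p ^ α            ≡⟨ cong (_* p ^ α) lcm≡L ⟨
      lcmModuli C * p ^ α          ∎
      where
      open ≡-Reasoning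
      open TransformedLcm adm lcm≡L

    C₁-distinct : IsDistinctCovering C → IsDistinctCovering C₁
    C₁-distinct (_ , unique , all>1) =
      C₁-covers ,
      subst Unique (sym moduli-C₁)
        (AllPairs-map-guarded newModulus (λ a a' n≢n' → n≢n' ∘ newModulus-injective a a') adm unique) ,
      subst (All (1 <_)) (sym moduli-C₁)
        (All.map⁺ (All.zipWith (λ (a , n>1) → newModulus-> a 1<p n>1) (adm , all>1)))

    C₁-least : (n₁ : ℕ) → IsLeastModulus C n₁ → (m : ℕ) → IsLeastModulus C₁ m → n₁ ⊓ p ≤ m
    C₁-least n₁ (_ , n₁≤moduli) m (m∈C₁ , _) with ∈-map⁻ newModulus (subst (m ∈_) moduli-C₁ m∈C₁)
    ... | n , n∈C , refl = newModulus-≥ (All.lookup adm n∈C) (All.lookup n₁≤moduli n∈C)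

lemma4 : (C : System) → IsCovering C →
         (q α p : ℕ) → Prime q → 1 ≤ α → ExactPowerDivides q α (lcmModuli C) →
         Prime p → ¬ (p ∣ lcmModuli C) → p < q →
         Σ System (λ C₁ →
           IsCovering C₁ ×
           lcmModuli C₁ * (q ^ α) ≡ lcmModuli C * (p ^ α) ×
           (IsDistinctCovering C → IsDistinctCovering C₁) ×
           ((n₁ : ℕ) → IsLeastModulus C n₁ →
             (m : ℕ) → IsLeastModulus C₁ m → n₁ ⊓ p ≤ m))
lemma4 C C-covers q α p q-prime α≥1 (q^α∣L , q^α+1∤L) p-prime p∤L p<q =
  C₁ , C₁-covers , C₁-lcm α≥1 , C₁-distinct , C₁-least
  where
  M = quotient q^α∣L
  L≡M*q^α : lcmModuli C ≡ M * q ^ α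
  L≡M*q^α = m∣n⇒n≡quotient*m q^α∣L
  q∤M : ¬ q ∣ M
  q∤M q∣M = q^α+1∤L (subst (q ^ suc α ∣_) (sym L≡M*q^α) (*-monoˡ-∣ (q ^ α) q∣M))
  p∤M : ¬ p ∣ M
  p∤M p∣M = p∤L (subst (p ∣_) (sym L≡M*q^α) (∣-trans p∣M (m∣m*n (q ^ α))))
  open Transformation q p α M q-prime p-prime p<q q∤M p∤M
  open TransformedSystem C C-covers L≡M*q^α
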